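{- Let $n$ be a positive integer and $\pi\in S_3$. The number of $n$-th order Latin Squares all of whose column permutations avoid $\pi$ is $n!$. Likewise, the number of $n$-th order Latin Squares all of whose row permutations avoid $\pi$ is $n!$.
   Context: An $n$-th order Latin Square is an $n\times n$ grid filled with the symbols $1,\dots,n$ such that each symbol appears exactly once in each row and each column. Rows read left to right give the row permutations; columns read top to bottom give the column permutations. A permutation $\sigma$ contains a pattern $\pi\in S_k$ if some length-$k$ subsequence of $\sigma$ is order isomorphic to $\pi$; otherwise it avoids $\pi$. -}

module Defs where

open import Data.Nat using (ℕ; suc)
open import Data.Fin using (Fin; _<_)
open import Data.Vec using (Vec; lookup; tabulate)
open import Data.List using (List; length)
open import Data.List.Membership.Propositional using (_∈_)
open import Data.List.Relation.Unary.Unique.Propositional using (Unique)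
open import Data.Product using (Σ; ∃; _×_)
open import Function.Bundles using (_⇔_)
open import Relation.Binary.PropositionalEquality using (_≡_)
open import Relation.Nullary using (¬_)

-- A permutation of {1..n} in one-line notation: a word of length n over Fin n
-- with pairwise distinct entries (for words of length n over n letters this is
-- exactly a bijection).
IsPerm : ∀ {n} → Vec (Fin n) n → Set
IsPerm {n} v = ∀ (i j : Fin n) → lookup v i ≡ lookup v j → i ≡ j

StrictlyIncreasing : ∀ {k n} → (Fin k → Fin n) → Set
StrictlyIncreasing {k} f = ∀ (a b : Fin k) → a < b → f a < f b

Contains : ∀ {n k} → Vec (Fin n) n → Vec (Fin k) k → Set
Contains {n} {k} σ π =
  Σ (Fin k → Fin n) λ f → StrictlyIncreasing f ×
    (∀ (a b : Fin k) → (lookup π a < lookup π b) ⇔ (lookup σ (f a) < lookup σ (f b)))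

Avoids : ∀ {n k} → Vec (Fin n) n → Vec (Fin k) k → Set
Avoids σ π = ¬ Contains σ π

-- An n×n grid: a vector of n rows, each a vector of n symbols (symbols 1..n
-- represented as Fin n).
Grid : ℕ → Set
Grid n = Vec (Vec (Fin n) n) n

row : ∀ {n} → Grid n → Fin n → Vec (Fin n) n
row L i = lookup L i

column : ∀ {n} → Grid n → Fin n → Vec (Fin n) n
column L j = tabulate (λ i → lookup (lookup L i) j)

-- Latin square: each symbol appears exactly once in each row and each column,
-- i.e. every row and every column is a permutation.
IsLatin : ∀ {n} → Grid n → Set
IsLatin {n} L = (∀ i → IsPerm (row L i)) × (∀ j → IsPerm (column L j))

-- "The number of objects satisfying P is m": there is a duplicate-free list of
-- length m whose members are exactly the objects satisfying P.
HasCount : ∀ {A : Set} → (A → Set) → ℕ → Set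
HasCount {A} P m = Σ (List A) λ xs → Unique xs × length xs ≡ m × (∀ x → (x ∈ xs) ⇔ P x)

module Submission where

-- For π = 132 the column j of such a square is forced to be the cyclically
-- increasing column t, t+1, …, n-1, 0, …, t-1 with t its top entry; for π = 123
-- it is the cyclically decreasing column t, t-1, …, 0, n-1, …, t+1.  The heart
-- of the proof (IncreasingColumn, DecreasingColumn) shows this for one column,
-- assuming that the columns with smaller top entries are already known: those
-- columns are excluded row by row, and pattern avoidance pins down the rest.
-- Strong induction on the top entry extends it to the whole square
-- (Counting.rigid), so a square is determined by its first row; conversely every
-- permutation of Fin n is the first row of such a square.  With the permutations
-- enumerated explicitly this gives the count n! (Counting.count).  The other four
-- patterns follow by complementing the entries (321, 312) and reversing the rows
-- (231, 213) of the squares, and the statement about rows by transposition.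

open import Defs
open import Data.Nat using (ℕ; zero; suc; _+_; _*_; _∸_; _≤_; _<_; _≥_; z≤n; s≤s; s≤s⁻¹; _!)
open import Data.Nat.Properties
open import Data.Fin as Fin using (Fin; zero; suc; toℕ; fromℕ<; punchIn; punchOut; opposite)
open import Data.Fin.Properties
  using (toℕ-injective; toℕ-fromℕ<; toℕ<n; opposite-prop; opposite-involutive; punchIn-injective; punchInᵢ≢i; punchOut-injective; punchIn-punchOut; any?; injective⇒≤)
  renaming (suc-injective to fsuc-injective)
open import Data.Vec as Vec using (Vec; []; _∷_; lookup; tabulate)
open import Data.Vec.Properties using (lookup-map; lookup∘tabulate; ∷-injective)
open import Data.Vec.Relation.Binary.Pointwise.Extensional using (ext; Pointwise-≡⇒≡)
open import Data.List as List using (List; length; cartesianProductWith; allFin)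
open import Data.List.Properties using (length-++; length-map; length-tabulate)
open import Data.List.Membership.Propositional using (_∈_)
open import Data.List.Membership.Propositional.Properties using (∈-cartesianProductWith⁺; ∈-cartesianProductWith⁻; ∈-allFin; ∈-map⁺; ∈-map⁻)
open import Data.List.Relation.Unary.Any using (here)
open import Data.List.Relation.Unary.All using ([])
open import Data.List.Relation.Unary.AllPairs using ([]; _∷_)
open import Data.List.Relation.Unary.Unique.Propositional using (Unique)
open import Data.List.Relation.Unary.Unique.Propositional.Properties using (cartesianProductWith⁺; allFin⁺; map⁺)
open import Data.Product using (Σ; ∃; _×_; _,_; proj₁; proj₂)
open import Data.Empty using (⊥; ⊥-elim)
open import Level using (0ℓ)
open import Induction.WellFounded using (module All)
open import Data.Fin.Induction using (<-wellFounded; >-wellFounded)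
open import Relation.Nullary using (yes; no)
open import Relation.Binary using (tri<; tri≈; tri>)
open import Function using (_∘_)
open import Function.Bundles using (mk⇔; Equivalence)
open import Relation.Binary.PropositionalEquality

lookup-ext : ∀ {A : Set} {n} {u v : Vec A n} → (∀ i → lookup u i ≡ lookup v i) → u ≡ v
lookup-ext p = Pointwise-≡⇒≡ (ext p)

injective⇒surjective : ∀ {n} (f : Fin n → Fin n) → (∀ a b → f a ≡ f b → a ≡ b) → ∀ y → ∃ λ x → f x ≡ y
injective⇒surjective {suc n} f f-inj y with any? (λ x → f x Fin.≟ y)
... | yes hit = hit
... | no miss = ⊥-elim (<-irrefl refl (injective⇒≤ squeeze-injective))
  where
  f≢y : ∀ x → y ≢ f x
  f≢y x y≡fx = miss (x , sym y≡fx)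
  -- f misses y, so it factors injectively through Fin n, which is too small.
  squeeze : Fin (suc n) → Fin n
  squeeze x = punchOut (f≢y x)
  squeeze-injective : ∀ {a b} → squeeze a ≡ squeeze b → a ≡ b
  squeeze-injective eq = f-inj _ _ (punchOut-injective (f≢y _) (f≢y _) eq)

perm-surjective : ∀ {n} {σ : Vec (Fin n) n} → IsPerm σ → ∀ y → ∃ λ i → lookup σ i ≡ y
perm-surjective {σ = σ} σ-perm = injective⇒surjective (lookup σ) σ-perm

-- The permutations of Fin n, listed: a permutation of Fin (suc n) is its first
-- entry a followed by a permutation of Fin n relabelled by punchIn a.
prepend : ∀ {n} → Fin (suc n) → Vec (Fin n) n → Vec (Fin (suc n)) (suc n)
prepend a τ = a ∷ Vec.map (punchIn a) τ

permutations : ∀ n → List (Vec (Fin n) n)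
permutations zero = [] List.∷ List.[]
permutations (suc n) = cartesianProductWith prepend (allFin (suc n)) (permutations n)

length-cartesianProductWith : ∀ {A B C : Set} (f : A → B → C) xs ys
  → length (cartesianProductWith f xs ys) ≡ length xs * length ys
length-cartesianProductWith f List.[] ys = refl
length-cartesianProductWith f (x List.∷ xs) ys = begin
  length (List.map (f x) ys List.++ cartesianProductWith f xs ys)  ≡⟨ length-++ (List.map (f x) ys) ⟩
  length (List.map (f x) ys) + length (cartesianProductWith f xs ys)
    ≡⟨ cong₂ _+_ (length-map (f x) ys) (length-cartesianProductWith f xs ys) ⟩
  length ys + length xs * length ys  ∎
  where open ≡-Reasoning

permutations-length : ∀ n → length (permutations n) ≡ n !
permutations-length zero = refl
permutations-length (suc n) = begin
  length (permutations (suc n))                      ≡⟨ length-cartesianProductWith prepend (allFin (suc n)) (permutations n) ⟩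
  length (allFin (suc n)) * length (permutations n)  ≡⟨ cong₂ _*_ (length-tabulate {n = suc n} (λ x → x)) (permutations-length n) ⟩
  suc n * n !                                        ∎
  where open ≡-Reasoning

prepend-injective : ∀ {n} {a b : Fin (suc n)} {τ ρ : Vec (Fin n) n} → prepend a τ ≡ prepend b ρ → a ≡ b × τ ≡ ρ
prepend-injective {a = a} {τ = τ} {ρ} eq with ∷-injective eq
... | refl , tails = refl , lookup-ext λ i → punchIn-injective a _ _ (begin
  punchIn a (lookup τ i)            ≡⟨ lookup-map i (punchIn a) τ ⟨
  lookup (Vec.map (punchIn a) τ) i  ≡⟨ cong (λ z → lookup z i) tails ⟩
  lookup (Vec.map (punchIn a) ρ) i  ≡⟨ lookup-map i (punchIn a) ρ ⟩
  punchIn a (lookup ρ i)            ∎)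
  where open ≡-Reasoning

permutations-unique : ∀ n → Unique (permutations n)
permutations-unique zero = [] ∷ []
permutations-unique (suc n) = cartesianProductWith⁺ prepend prepend-injective (allFin⁺ (suc n)) (permutations-unique n)

prepend-perm : ∀ {n} (a : Fin (suc n)) (τ : Vec (Fin n) n) → IsPerm τ → IsPerm (prepend a τ)
prepend-perm a τ τ-perm zero zero _ = refl
prepend-perm a τ τ-perm zero (suc j) eq = ⊥-elim (punchInᵢ≢i a (lookup τ j) (sym (trans eq (lookup-map j (punchIn a) τ))))
prepend-perm a τ τ-perm (suc i) zero eq = ⊥-elim (punchInᵢ≢i a (lookup τ i) (trans (sym (lookup-map i (punchIn a) τ)) eq))
prepend-perm a τ τ-perm (suc i) (suc j) eq = cong suc (τ-perm i j (punchIn-injective a _ _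
  (trans (sym (lookup-map i (punchIn a) τ)) (trans eq (lookup-map j (punchIn a) τ)))))

permutations-sound : ∀ n {σ : Vec (Fin n) n} → σ ∈ permutations n → IsPerm σ
permutations-sound zero _ () ()
permutations-sound (suc n) σ∈ with ∈-cartesianProductWith⁻ prepend (allFin (suc n)) (permutations n) σ∈
... | a , τ , _ , τ∈ , refl = prepend-perm a τ (permutations-sound n τ∈)

permutations-complete : ∀ n {σ : Vec (Fin n) n} → IsPerm σ → σ ∈ permutations n
permutations-complete zero {[]} _ = here refl
permutations-complete (suc n) {a ∷ σ} σ-perm =
  subst (_∈ permutations (suc n)) restore (∈-cartesianProductWith⁺ prepend (∈-allFin a) (permutations-complete n τ-perm))
  where
  a∉σ : ∀ i → a ≢ lookup σ i
  a∉σ i eq with σ-perm zero (suc i) eq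
  ... | ()
  τ : Vec (Fin n) n
  τ = tabulate (λ i → punchOut (a∉σ i))
  τ-perm : IsPerm τ
  τ-perm i j eq = fsuc-injective (σ-perm (suc i) (suc j) (punchOut-injective (a∉σ i) (a∉σ j)
    (trans (sym (lookup∘tabulate _ i)) (trans eq (lookup∘tabulate _ j)))))
  restore : prepend a τ ≡ a ∷ σ
  restore = cong (a ∷_) (lookup-ext λ i → trans (lookup-map i (punchIn a) τ)
    (trans (cong (punchIn a) (lookup∘tabulate _ i)) (punchIn-punchOut (a∉σ i))))

triple : ∀ {n} → Fin n → Fin n → Fin n → Fin 3 → Fin n
triple a b c zero = a
triple a b c (suc zero) = b
triple a b c (suc (suc zero)) = c

triple-increasing : ∀ {n} {a b c : Fin n} → a Fin.< b → b Fin.< c → StrictlyIncreasing (triple a b c)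
triple-increasing a<b b<c zero (suc zero) _ = a<b
triple-increasing a<b b<c zero (suc (suc zero)) _ = <-trans a<b b<c
triple-increasing a<b b<c (suc zero) (suc (suc zero)) _ = b<c
triple-increasing a<b b<c zero zero ()
triple-increasing a<b b<c (suc zero) zero ()
triple-increasing a<b b<c (suc zero) (suc zero) (s≤s ())
triple-increasing a<b b<c (suc (suc zero)) zero ()
triple-increasing a<b b<c (suc (suc zero)) (suc zero) (s≤s ())
triple-increasing a<b b<c (suc (suc zero)) (suc (suc zero)) (s≤s (s≤s ()))

increasing-reflects : ∀ {k n} {h : Fin k → Fin n} → StrictlyIncreasing h → ∀ a b → h a Fin.< h b → a Fin.< b
increasing-reflects {h = h} h-inc a b ha<hb with <-cmp (toℕ a) (toℕ b)
... | tri< a<b _ _ = a<b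
... | tri≈ _ a≡b _ = ⊥-elim (<-irrefl (cong (toℕ ∘ h) (toℕ-injective a≡b)) ha<hb)
... | tri> _ _ b<a = ⊥-elim (<-asym ha<hb (h-inc b a b<a))

contains-via : ∀ {n k} (σ : Vec (Fin n) n) (π : Vec (Fin k) k) {f h : Fin k → Fin n}
  → StrictlyIncreasing f → StrictlyIncreasing h → (∀ a → lookup σ (f a) ≡ h (lookup π a)) → Contains σ π
contains-via σ π {f} {h} f-inc h-inc σf≡hπ = f , f-inc , λ a b → mk⇔ (preserve a b) (reflect a b)
  where
  preserve : ∀ a b → lookup π a Fin.< lookup π b → lookup σ (f a) Fin.< lookup σ (f b)
  preserve a b πa<πb = subst₂ Fin._<_ (sym (σf≡hπ a)) (sym (σf≡hπ b)) (h-inc _ _ πa<πb)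
  reflect : ∀ a b → lookup σ (f a) Fin.< lookup σ (f b) → lookup π a Fin.< lookup π b
  reflect a b σfa<σfb = increasing-reflects h-inc _ _ (subst₂ Fin._<_ (σf≡hπ a) (σf≡hπ b) σfa<σfb)

-- The two patterns to which all of S₃ reduces.
π123 : Vec (Fin 3) 3
π123 = zero ∷ suc zero ∷ suc (suc zero) ∷ []

π132 : Vec (Fin 3) 3
π132 = zero ∷ suc (suc zero) ∷ suc zero ∷ []

contains123 : ∀ {n} (σ : Vec (Fin n) n) {p q r : Fin n} → p Fin.< q → q Fin.< r
  → lookup σ p Fin.< lookup σ q → lookup σ q Fin.< lookup σ r → Contains σ π123
contains123 σ p<q q<r σp<σq σq<σr =
  contains-via σ π123 (triple-increasing p<q q<r) (triple-increasing σp<σq σq<σr)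
    λ { zero → refl ; (suc zero) → refl ; (suc (suc zero)) → refl }

contains132 : ∀ {n} (σ : Vec (Fin n) n) {p q r : Fin n} → p Fin.< q → q Fin.< r
  → lookup σ p Fin.< lookup σ r → lookup σ r Fin.< lookup σ q → Contains σ π132
contains132 σ p<q q<r σp<σr σr<σq =
  contains-via σ π132 (triple-increasing p<q q<r) (triple-increasing σp<σr σr<σq)
    λ { zero → refl ; (suc zero) → refl ; (suc (suc zero)) → refl }

-- `Cyclic n u K x` says x ≡ u + K (mod n) for u, K, x < n: the sum either does
-- not wrap around (`no-wrap`) or wraps around exactly once (`wrap`).
data Cyclic (n u K x : ℕ) : Set where
  no-wrap : u + K < n → x ≡ u + K → Cyclic n u K x
  wrap    : n ≤ u + K → x + n ≡ u + K → Cyclic n u K x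

cyclic-comm : ∀ {n u K x} → Cyclic n u K x → Cyclic n K u x
cyclic-comm {n} {u} {K} (no-wrap s<n x≡s) = no-wrap (subst (_< n) (+-comm u K) s<n) (trans x≡s (+-comm u K))
cyclic-comm {n} {u} {K} (wrap n≤s x+n≡s) = wrap (subst (n ≤_) (+-comm u K) n≤s) (trans x+n≡s (+-comm u K))

cyclic-unique : ∀ {n u K x y} → Cyclic n u K x → Cyclic n u K y → x ≡ y
cyclic-unique (no-wrap _ x≡s) (no-wrap _ y≡s) = trans x≡s (sym y≡s)
cyclic-unique (no-wrap s<n _) (wrap n≤s _) = ⊥-elim (<⇒≱ s<n n≤s)
cyclic-unique (wrap n≤s _) (no-wrap s<n _) = ⊥-elim (<⇒≱ s<n n≤s)
cyclic-unique {n} {x = x} {y} (wrap _ x+n≡s) (wrap _ y+n≡s) = +-cancelʳ-≡ n x y (trans x+n≡s (sym y+n≡s))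

wraps-past : ∀ {n u u' K} → u' < n → u' + K < u + K + n
wraps-past {n} {u} {u'} {K} u'<n =
  <-≤-trans (+-monoˡ-< K u'<n) (subst (_≤ u + K + n) (+-comm K n) (+-monoˡ-≤ n (m≤n+m K u)))

cyclic-cancelˡ : ∀ {n u u' K x} → u < n → u' < n → Cyclic n u K x → Cyclic n u' K x → u ≡ u'
cyclic-cancelˡ {K = K} _ _ (no-wrap _ a) (no-wrap _ b) = +-cancelʳ-≡ K _ _ (trans (sym a) b)
cyclic-cancelˡ {K = K} _ _ (wrap _ a) (wrap _ b) = +-cancelʳ-≡ K _ _ (trans (sym a) b)
cyclic-cancelˡ _ u'<n (no-wrap _ a) (wrap _ b) = ⊥-elim (<-irrefl (trans (sym b) (cong (_+ _) a)) (wraps-past u'<n))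
cyclic-cancelˡ u<n _ (wrap _ a) (no-wrap _ b) = ⊥-elim (<-irrefl (trans (sym a) (cong (_+ _) b)) (wraps-past u<n))

cyclic-cancelʳ : ∀ {n u K K' x} → K < n → K' < n → Cyclic n u K x → Cyclic n u K' x → K ≡ K'
cyclic-cancelʳ {u = u} K<n K'<n c c' = cyclic-cancelˡ K<n K'<n (cyclic-comm {u = u} c) (cyclic-comm {u = u} c')

-- `Descent n u K x`: x ≡ u - K (mod n), split by whether K ≤ u.  Every residue
-- x with x + K ≡ u (mod n) is such a descent.
data Descent (n u K x : ℕ) : Set where
  no-wrap : K ≤ u → x + K ≡ u → Descent n u K x
  wrap    : u < K → x + K ≡ u + n → Descent n u K x

cyclic⇒descent : ∀ {n u K x} → x < n → Cyclic n x K u → Descent n u K x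
cyclic⇒descent {K = K} {x} _ (no-wrap _ u≡x+K) = no-wrap (subst (K ≤_) (sym u≡x+K) (m≤n+m K x)) (sym u≡x+K)
cyclic⇒descent {n} {u} {K} {x} x<n (wrap _ u+n≡x+K) =
  wrap (+-cancelʳ-< n u K (<-≤-trans (≤-<-trans (≤-reflexive u+n≡x+K) (+-monoˡ-< K x<n)) (≤-reflexive (+-comm n K)))) (sym u+n≡x+K)

-- The values of a "cyclically increasing" column u, u+1, …, n-1, 0, …, u-1 never
-- form a 132 pattern: both runs increase and the first lies above the second.
cyclic-no132 : ∀ {n u P Q R xp xq xr} → P < Q → Q < R → R < n
  → Cyclic n u P xp → Cyclic n u Q xq → Cyclic n u R xr → xp < xr → xr < xq → ⊥
cyclic-no132 {u = u} _ Q<R _ _ (wrap n≤u+Q _) (no-wrap u+R<n _) _ _ = <⇒≱ (<-trans (+-monoʳ-< u Q<R) u+R<n) n≤u+Q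
cyclic-no132 {n} {u} _ Q<R _ _ (wrap _ q) (wrap _ r) _ xr<xq = <-asym (+-monoʳ-< u Q<R) (subst₂ _<_ r q (+-monoˡ-< n xr<xq))
cyclic-no132 {u = u} _ Q<R _ _ (no-wrap _ q) (no-wrap _ r) _ xr<xq = <-asym (+-monoʳ-< u Q<R) (subst₂ _<_ r q xr<xq)
cyclic-no132 {n} {u} {P} {xr = xr} _ _ R<n (no-wrap _ p) (no-wrap _ _) (wrap _ r) xp<xr _ =
  <⇒≱ (<-trans xp<xr xr<u) (subst (u ≤_) (sym p) (m≤m+n u P))
  where
  xr<u : xr < u
  xr<u = +-cancelʳ-< n xr u (subst (_< u + n) (sym r) (+-monoʳ-< u R<n))
cyclic-no132 {u = u} P<Q _ _ (wrap n≤u+P _) (no-wrap u+Q<n _) (wrap _ _) _ _ =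
  <⇒≱ (≤-<-trans (+-monoʳ-≤ u (<⇒≤ P<Q)) u+Q<n) n≤u+P

-- The values of a "cyclically decreasing" column u, u-1, …, 0, n-1, …, u+1 never
-- form a 123 pattern: both runs decrease.
descent-no123 : ∀ {n u P Q R xp xq xr} → P < Q → Q < R
  → Descent n u P xp → Descent n u Q xq → Descent n u R xr → xp < xq → xq < xr → ⊥
descent-no123 P<Q _ (no-wrap _ p) (no-wrap _ q) _ xp<xq _ = <-irrefl (trans p (sym q)) (+-mono-< xp<xq P<Q)
descent-no123 P<Q _ (wrap u<P _) (no-wrap Q≤u _) _ _ _ = <⇒≱ (<-trans u<P P<Q) Q≤u
descent-no123 _ Q<R _ (wrap u<Q _) (no-wrap R≤u _) _ _ = <⇒≱ (<-trans u<Q Q<R) R≤u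
descent-no123 _ Q<R _ (wrap _ q) (wrap _ r) _ xq<xr = <-irrefl (trans q (sym r)) (+-mono-< xq<xr Q<R)

tabulate-avoids132 : ∀ {n} (g : Fin n → Fin n)
  → (∀ {p q r} → p Fin.< q → q Fin.< r → g p Fin.< g r → g r Fin.< g q → ⊥) → Avoids (tabulate g) π132
tabulate-avoids132 g no-occurrence (f , f-inc , iff) =
  no-occurrence (f-inc zero (suc zero) (s≤s z≤n)) (f-inc (suc zero) (suc (suc zero)) (s≤s (s≤s z≤n)))
    (subst₂ Fin._<_ (lookup∘tabulate g (f zero)) (lookup∘tabulate g (f (suc (suc zero))))
      (Equivalence.to (iff zero (suc (suc zero))) (s≤s z≤n)))
    (subst₂ Fin._<_ (lookup∘tabulate g (f (suc (suc zero)))) (lookup∘tabulate g (f (suc zero)))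
      (Equivalence.to (iff (suc (suc zero)) (suc zero)) (s≤s (s≤s z≤n))))

tabulate-avoids123 : ∀ {n} (g : Fin n → Fin n)
  → (∀ {p q r} → p Fin.< q → q Fin.< r → g p Fin.< g q → g q Fin.< g r → ⊥) → Avoids (tabulate g) π123
tabulate-avoids123 g no-occurrence (f , f-inc , iff) =
  no-occurrence (f-inc zero (suc zero) (s≤s z≤n)) (f-inc (suc zero) (suc (suc zero)) (s≤s (s≤s z≤n)))
    (subst₂ Fin._<_ (lookup∘tabulate g (f zero)) (lookup∘tabulate g (f (suc zero)))
      (Equivalence.to (iff zero (suc zero)) (s≤s z≤n)))
    (subst₂ Fin._<_ (lookup∘tabulate g (f (suc zero))) (lookup∘tabulate g (f (suc (suc zero))))
      (Equivalence.to (iff (suc zero) (suc (suc zero))) (s≤s (s≤s z≤n))))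

-- The cyclic columns of order n = suc m with top entry u:
-- shiftUp u k = u + k and shiftDown u k = u - k, modulo n.
shiftUp : ∀ {m} → Fin (suc m) → Fin (suc m) → Fin (suc m)
shiftUp {m} u k with toℕ u + toℕ k <? suc m
... | yes s<n = fromℕ< s<n
... | no _ = fromℕ< (m<n+o⇒m∸n<o (toℕ u + toℕ k) (suc m) (+-mono-< (toℕ<n u) (toℕ<n k)))

shiftUp-cyclic : ∀ {m} (u k : Fin (suc m)) → Cyclic (suc m) (toℕ u) (toℕ k) (toℕ (shiftUp u k))
shiftUp-cyclic {m} u k with toℕ u + toℕ k <? suc m
... | yes s<n = no-wrap s<n (toℕ-fromℕ< s<n)
... | no s≮n = wrap (≮⇒≥ s≮n) (trans (cong (_+ suc m) (toℕ-fromℕ< _)) (m∸n+n≡m (≮⇒≥ s≮n)))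

shiftDown : ∀ {m} → Fin (suc m) → Fin (suc m) → Fin (suc m)
shiftDown {m} u k with toℕ k ≤? toℕ u
... | yes _ = fromℕ< (≤-<-trans (m∸n≤m (toℕ u) (toℕ k)) (toℕ<n u))
... | no K≰u = fromℕ< (m<n+o⇒m∸n<o (toℕ u + suc m) (toℕ k) (+-monoˡ-< (suc m) (≰⇒> K≰u)))

shiftDown-cyclic : ∀ {m} (u k : Fin (suc m)) → Cyclic (suc m) (toℕ (shiftDown u k)) (toℕ k) (toℕ u)
shiftDown-cyclic {m} u k with toℕ k ≤? toℕ u
... | yes K≤u = no-wrap (subst (_< suc m) (sym x+K≡u) (toℕ<n u)) (sym x+K≡u)
  where
  x+K≡u : toℕ (fromℕ< _) + toℕ k ≡ toℕ u
  x+K≡u = trans (cong (_+ toℕ k) (toℕ-fromℕ< _)) (m∸n+n≡m K≤u)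
... | no K≰u = wrap (subst (suc m ≤_) (sym x+K≡u+n) (m≤n+m (suc m) (toℕ u))) (sym x+K≡u+n)
  where
  x+K≡u+n : toℕ (fromℕ< _) + toℕ k ≡ toℕ u + suc m
  x+K≡u+n = trans (cong (_+ toℕ k) (toℕ-fromℕ< _)) (m∸n+n≡m (≤-trans (<⇒≤ (toℕ<n k)) (m≤n+m (suc m) (toℕ u))))

-- Shifting by 0 changes nothing; for fixed k the shifts of different tops
-- differ (rows of a square), and each shift is a permutation (columns).
cyclic-zero : ∀ {n u} → u < n → Cyclic n u 0 u
cyclic-zero {n} {u} u<n = no-wrap (subst (_< n) (sym (+-identityʳ u)) u<n) (sym (+-identityʳ u))

shiftUp-zero : ∀ {m} (u : Fin (suc m)) → shiftUp u zero ≡ u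
shiftUp-zero u = toℕ-injective (cyclic-unique (shiftUp-cyclic u zero) (cyclic-zero (toℕ<n u)))

shiftDown-zero : ∀ {m} (u : Fin (suc m)) → shiftDown u zero ≡ u
shiftDown-zero u = toℕ-injective (cyclic-cancelˡ (toℕ<n (shiftDown u zero)) (toℕ<n u) (shiftDown-cyclic u zero) (cyclic-zero (toℕ<n u)))

shiftUp-injectiveˡ : ∀ {m} (k : Fin (suc m)) {u u'} → shiftUp u k ≡ shiftUp u' k → u ≡ u'
shiftUp-injectiveˡ k {u} {u'} eq = toℕ-injective (cyclic-cancelˡ (toℕ<n u) (toℕ<n u')
  (shiftUp-cyclic u k) (subst (Cyclic _ _ _) (cong toℕ (sym eq)) (shiftUp-cyclic u' k)))

shiftUp-injectiveʳ : ∀ {m} (u : Fin (suc m)) {k k'} → shiftUp u k ≡ shiftUp u k' → k ≡ k'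
shiftUp-injectiveʳ u {k} {k'} eq = toℕ-injective (cyclic-cancelʳ (toℕ<n k) (toℕ<n k')
  (shiftUp-cyclic u k) (subst (Cyclic _ _ _) (cong toℕ (sym eq)) (shiftUp-cyclic u k')))

shiftDown-injectiveˡ : ∀ {m} (k : Fin (suc m)) {u u'} → shiftDown u k ≡ shiftDown u' k → u ≡ u'
shiftDown-injectiveˡ k {u} {u'} eq = toℕ-injective (cyclic-unique
  (shiftDown-cyclic u k) (subst (λ x → Cyclic _ x _ _) (cong toℕ (sym eq)) (shiftDown-cyclic u' k)))

shiftDown-injectiveʳ : ∀ {m} (u : Fin (suc m)) {k k'} → shiftDown u k ≡ shiftDown u k' → k ≡ k'
shiftDown-injectiveʳ u {k} {k'} eq = toℕ-injective (cyclic-cancelʳ (toℕ<n k) (toℕ<n k')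
  (shiftDown-cyclic u k) (subst (λ x → Cyclic _ x _ _) (cong toℕ (sym eq)) (shiftDown-cyclic u k')))

shiftUp-avoids : ∀ {m} (u : Fin (suc m)) → Avoids (tabulate (shiftUp u)) π132
shiftUp-avoids u = tabulate-avoids132 (shiftUp u) λ {p} {q} {r} p<q q<r →
  cyclic-no132 p<q q<r (toℕ<n r) (shiftUp-cyclic u p) (shiftUp-cyclic u q) (shiftUp-cyclic u r)

shiftDown-avoids : ∀ {m} (u : Fin (suc m)) → Avoids (tabulate (shiftDown u)) π123
shiftDown-avoids u = tabulate-avoids123 (shiftDown u) λ {p} {q} {r} p<q q<r →
  descent-no123 p<q q<r (descent p) (descent q) (descent r)
  where
  descent : ∀ k → Descent _ (toℕ u) (toℕ k) (toℕ (shiftDown u k))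
  descent k = cyclic⇒descent (toℕ<n (shiftDown u k)) (shiftDown-cyclic u k)

module ColumnBasics {m} (σ : Vec (Fin (suc m)) (suc m)) (σ-perm : IsPerm σ) where
  n : ℕ
  n = suc m

  V : Fin n → ℕ
  V k = toℕ (lookup σ k)

  v : ℕ
  v = V zero

  V<n : ∀ k → V k < n
  V<n k = toℕ<n (lookup σ k)

  same-value : ∀ {p q} → V p ≡ V q → toℕ p ≡ toℕ q
  same-value Vp≡Vq = cong toℕ (σ-perm _ _ (toℕ-injective Vp≡Vq))

  after-top : ∀ {k} → V k ≢ v → 0 < toℕ k
  after-top {zero} Vk≢v = ⊥-elim (Vk≢v refl)
  after-top {suc k} _ = s≤s z≤n

  position : ∀ K → K < n → Σ (Fin n) λ k → toℕ k ≡ K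
  position K K<n = fromℕ< K<n , toℕ-fromℕ< K<n

  position-of : ∀ w → w < n → Σ (Fin n) λ p → V p ≡ w
  position-of w w<n with perm-surjective {σ = σ} σ-perm (fromℕ< w<n)
  ... | p , σp≡w = p , trans (cong toℕ σp≡w) (toℕ-fromℕ< w<n)

  maximum : Σ (Fin n) λ q → V q ≡ m
  maximum = position-of m (n<1+n m)

-- First the positions k with v + k ≥ n are settled by
-- descending induction (`wrapped`), then those with v + k < n by ascending
-- induction (`unwrapped`).
module IncreasingColumn {m} (σ : Vec (Fin (suc m)) (suc m)) (σ-perm : IsPerm σ) (σ-avoids : Avoids σ π132)
  (off-diagonal : ∀ u k → u Fin.< lookup σ zero → lookup σ k ≢ shiftUp u k) where
  open ColumnBasics σ σ-perm

  not-smaller-shift : ∀ {u k} → u < v → Cyclic n u (toℕ k) (V k) → ⊥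
  not-smaller-shift {u} {k} u<v Vk≡u+k = off-diagonal û k û<v (toℕ-injective (cyclic-unique Vk≡u+k û+k))
    where
    u<n = <-trans u<v (V<n zero)
    û = fromℕ< u<n
    û<v : toℕ û < v
    û<v = subst (_< v) (sym (toℕ-fromℕ< u<n)) u<v
    û+k : Cyclic n u (toℕ k) (toℕ (shiftUp û k))
    û+k = subst (λ w → Cyclic n w (toℕ k) (toℕ (shiftUp û k))) (toℕ-fromℕ< u<n) (shiftUp-cyclic û k)

  no132 : ∀ {q r} → 0 < toℕ q → toℕ q < toℕ r → v < V r → V r < V q → ⊥
  no132 {q} {r} 0<q q<r v<Vr Vr<Vq = σ-avoids (contains132 σ {p = zero} {q} {r} 0<q q<r v<Vr Vr<Vq)

  home-below : ∀ {x} → x < v → Σ (Fin n) λ k' → v + toℕ k' ≡ x + n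
  home-below {x} x<v = proj₁ k' , trans (cong (v +_) (proj₂ k')) v+K'≡x+n
    where
    v+K'≡x+n : v + (x + n ∸ v) ≡ x + n
    v+K'≡x+n = m+[n∸m]≡n (≤-trans (<⇒≤ (V<n zero)) (m≤n+m n x))
    k' = position (x + n ∸ v) (+-cancelˡ-< v _ n (subst (_< v + n) (sym v+K'≡x+n) (+-monoˡ-< n x<v)))

  Wrapped : Fin n → Set
  Wrapped k = n ≤ v + toℕ k → V k + n ≡ v + toℕ k

  module WrappedStep (k : Fin n) (later : ∀ {k'} → toℕ k < toℕ k' → Wrapped k') (n≤v+K : n ≤ v + toℕ k) where
    K = toℕ k

    -- v sits at position 0, which does not wrap
    not-top : V k ≢ v
    not-top Vk≡v = <⇒≱ (V<n zero) (≤-trans n≤v+K (≤-reflexive (trans (cong (v +_) (same-value Vk≡v)) (+-identityʳ v))))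

    -- a value above v here would be the maximum m (all later values are below v),
    -- but m = u + k for u = m - k < v
    not-above : v < V k → ⊥
    not-above v<Vk with maximum
    ... | q , Vq≡m with <-cmp K (toℕ q)
    ...   | tri< k<q _ _ = <-irrefl (sym (trans (cong (_+ n) (sym Vq≡m)) (later k<q n≤v+Q))) v+Q<m+n
      where
      n≤v+Q = ≤-trans n≤v+K (+-monoʳ-≤ v (<⇒≤ k<q))
      v+Q<m+n : v + toℕ q < m + n
      v+Q<m+n = ≤-<-trans (+-mono-≤ (s≤s⁻¹ (V<n zero)) (s≤s⁻¹ (toℕ<n q))) (+-monoʳ-< m (n<1+n m))
    ...   | tri≈ _ K≡Q _ = not-smaller-shift {u = m ∸ K} u<v (no-wrap (subst (_< n) (sym u+K≡m) (n<1+n m)) (trans Vk≡m (sym u+K≡m)))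
      where
      Vk≡m = trans (cong V (toℕ-injective K≡Q)) Vq≡m
      u+K≡m : m ∸ K + K ≡ m
      u+K≡m = m∸n+n≡m (s≤s⁻¹ (toℕ<n k))
      u<v : m ∸ K < v
      u<v = +-cancelʳ-< K _ v (subst (_< v + K) (sym u+K≡m) n≤v+K)
    ...   | tri> _ _ q<k = no132 {q} {k} (after-top (λ Vq≡v → <⇒≱ v<Vk (subst (V k ≤_) (trans (sym Vq≡m) Vq≡v) Vk≤m))) q<k v<Vk Vk<m
      where
      Vk≤m = s≤s⁻¹ (V<n k)
      Vk<m : V k < V q
      Vk<m = subst (V k <_) (sym Vq≡m) (≤∧≢⇒< Vk≤m λ Vk≡m → <-irrefl (same-value (trans Vq≡m (sym Vk≡m))) q<k)

    -- a value x below v belongs at the position with v + k' = x + n; if that is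
    -- k we are done, if it is later the induction hypothesis places x there, and
    -- if it is earlier then x = u + k for u < v
    below : V k < v → V k + n ≡ v + K
    below Vk<v with <-cmp (V k + n) (v + K)
    ... | tri≈ _ eq _ = eq
    ... | tri< Vk+n<v+K _ _ = ⊥-elim (not-smaller-shift {u = V k + n ∸ K} u<v (wrap n≤u+K (sym u+K≡Vk+n)))
      where
      u+K≡Vk+n : V k + n ∸ K + K ≡ V k + n
      u+K≡Vk+n = m∸n+n≡m (≤-trans (<⇒≤ (toℕ<n k)) (m≤n+m n (V k)))
      n≤u+K = subst (n ≤_) (sym u+K≡Vk+n) (m≤n+m n (V k))
      u<v = +-cancelʳ-< K _ v (subst (_< v + K) (sym u+K≡Vk+n) Vk+n<v+K)
    ... | tri> _ _ v+K<Vk+n with home-below Vk<v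
    ...   | k' , v+K'≡Vk+n = ⊥-elim (<-irrefl (sym (same-value Vk'≡Vk)) K<K')
      where
      K<K' = +-cancelˡ-< v K _ (subst (v + K <_) (sym v+K'≡Vk+n) v+K<Vk+n)
      Vk'≡Vk = +-cancelʳ-≡ n _ _ (trans (later K<K' (subst (n ≤_) (sym v+K'≡Vk+n) (m≤n+m n (V k)))) v+K'≡Vk+n)

    step : V k + n ≡ v + K
    step with <-cmp (V k) v
    ... | tri< Vk<v _ _ = below Vk<v
    ... | tri≈ _ Vk≡v _ = ⊥-elim (not-top Vk≡v)
    ... | tri> _ _ v<Vk = ⊥-elim (not-above v<Vk)

  wrapped : ∀ k → Wrapped k
  wrapped = All.wfRec >-wellFounded 0ℓ Wrapped λ k later → WrappedStep.step k later

  Unwrapped : Fin n → Set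
  Unwrapped k = v + toℕ k < n → V k ≡ v + toℕ k

  module UnwrappedStep (k : Fin n) (earlier : ∀ {k'} → toℕ k' < toℕ k → Unwrapped k') (v+K<n : v + toℕ k < n) where
    K = toℕ k

    -- values below v live in the wrapped part
    not-below : V k < v → ⊥
    not-below Vk<v with home-below Vk<v
    ... | k' , v+K'≡Vk+n = <⇒≱ v+K<n (subst (λ K → n ≤ v + K) K'≡K (subst (n ≤_) (sym v+K'≡Vk+n) (m≤n+m n (V k))))
      where
      K'≡K = same-value (+-cancelʳ-≡ n _ _ (trans (wrapped k' (subst (n ≤_) (sym v+K'≡Vk+n) (m≤n+m n (V k)))) v+K'≡Vk+n))

    -- a value x > v: if x < v + k it was already used at the earlier position
    -- x - v; if x > v + k then v + k comes later, and v, x, v + k is a 132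
    above : v < V k → V k ≡ v + K
    above v<Vk with <-cmp (V k) (v + K)
    ... | tri≈ _ eq _ = eq
    ... | tri< Vk<v+K _ _ = ⊥-elim (<-irrefl (same-value (trans (earlier K'<K (subst (_< n) (sym v+K'≡Vk) (V<n k))) v+K'≡Vk)) K'<K)
      where
      at = position (V k ∸ v) (≤-<-trans (m∸n≤m (V k) v) (V<n k))
      k' = proj₁ at
      v+K'≡Vk : v + toℕ k' ≡ V k
      v+K'≡Vk = trans (cong (v +_) (proj₂ at)) (m+[n∸m]≡n (<⇒≤ v<Vk))
      K'<K = +-cancelˡ-< v _ K (subst (_< v + K) (sym v+K'≡Vk) Vk<v+K)
    ... | tri> _ _ v+K<Vk with position-of (v + K) v+K<n
    ...   | p , Vp≡v+K with <-cmp (toℕ p) K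
    ...     | tri< p<k _ _ = ⊥-elim (<-irrefl (+-cancelˡ-≡ v _ _ (trans (sym (earlier p<k v+P<n)) Vp≡v+K)) p<k)
      where
      v+P<n = ≤-<-trans (+-monoʳ-≤ v (<⇒≤ p<k)) v+K<n
    ...     | tri≈ _ P≡K _ = ⊥-elim (<-irrefl (sym (trans (cong V (toℕ-injective (sym P≡K))) Vp≡v+K)) v+K<Vk)
    ...     | tri> _ _ k<p = ⊥-elim (no132 {k} {p} 0<K k<p (subst (v <_) (sym Vp≡v+K) (m<m+n v 0<K)) (subst (_< V k) (sym Vp≡v+K) v+K<Vk))
      where
      0<K = after-top (λ Vk≡v → <-irrefl (sym Vk≡v) v<Vk)

    step : V k ≡ v + K
    step with <-cmp (V k) v
    ... | tri< Vk<v _ _ = ⊥-elim (not-below Vk<v)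
    ... | tri≈ _ Vk≡v _ = trans Vk≡v (sym (trans (cong (v +_) (same-value Vk≡v)) (+-identityʳ v)))
    ... | tri> _ _ v<Vk = above v<Vk

  unwrapped : ∀ k → Unwrapped k
  unwrapped = All.wfRec <-wellFounded 0ℓ Unwrapped λ k earlier → UnwrappedStep.step k earlier

  forced : ∀ k → lookup σ k ≡ shiftUp (lookup σ zero) k
  forced k = toℕ-injective (cyclic-unique Vk≡v+k (shiftUp-cyclic (lookup σ zero) k))
    where
    Vk≡v+k : Cyclic n v (toℕ k) (V k)
    Vk≡v+k with v + toℕ k <? n
    ... | yes v+K<n = no-wrap v+K<n (unwrapped k v+K<n)
    ... | no v+K≮n = wrap (≮⇒≥ v+K≮n) (wrapped k (≮⇒≥ v+K≮n))

-- The positions k ≤ v (which should read v - k)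
-- are settled first (`early`), then the positions k > v (which should read
-- v + n - k, `late`), both by ascending induction.
module DecreasingColumn {m} (σ : Vec (Fin (suc m)) (suc m)) (σ-perm : IsPerm σ) (σ-avoids : Avoids σ π123)
  (off-diagonal : ∀ u k → u Fin.< lookup σ zero → lookup σ k ≢ shiftDown u k) where
  open ColumnBasics σ σ-perm

  not-smaller-shift : ∀ {u k} → u < v → Cyclic n (V k) (toℕ k) u → ⊥
  not-smaller-shift {u} {k} u<v Vk+k≡u =
    off-diagonal û k û<v (toℕ-injective (cyclic-cancelˡ (V<n k) (toℕ<n (shiftDown û k)) Vk+k≡u x+k≡u))
    where
    u<n = <-trans u<v (V<n zero)
    û = fromℕ< u<n
    û<v : toℕ û < v
    û<v = subst (_< v) (sym (toℕ-fromℕ< u<n)) u<v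
    x+k≡u : Cyclic n (toℕ (shiftDown û k)) (toℕ k) u
    x+k≡u = subst (Cyclic n (toℕ (shiftDown û k)) (toℕ k)) (toℕ-fromℕ< u<n) (shiftDown-cyclic û k)

  no123 : ∀ {q r} → 0 < toℕ q → toℕ q < toℕ r → v < V q → V q < V r → ⊥
  no123 {q} {r} 0<q q<r v<Vq Vq<Vr = σ-avoids (contains123 σ {p = zero} {q} {r} 0<q q<r v<Vq Vq<Vr)

  home-early : ∀ {x} → x ≤ v → Σ (Fin n) λ k' → x + toℕ k' ≡ v
  home-early {x} x≤v = proj₁ at , trans (cong (x +_) (proj₂ at)) (m+[n∸m]≡n x≤v)
    where
    at = position (v ∸ x) (≤-<-trans (m∸n≤m v x) (V<n zero))

  maximum-wraps : ∀ {K} → 0 < K → K ≤ v → Σ ℕ λ u → u < v × Cyclic n m K u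
  maximum-wraps {suc K} _ K<v = K , K<v , wrap n≤m+1+K (trans (+-suc K m) (trans (cong suc (+-comm K m)) (sym (+-suc m K))))
    where
    n≤m+1+K = subst (n ≤_) (sym (+-suc m K)) (s≤s (m≤m+n m K))

  Early : Fin n → Set
  Early k = toℕ k ≤ v → V k + toℕ k ≡ v

  module EarlyStep (k : Fin n) (earlier : ∀ {k'} → toℕ k' < toℕ k → Early k') (K≤v : toℕ k ≤ v) where
    K = toℕ k

    -- a value above v here would be the maximum m (earlier values are at most v),
    -- but m = u - k for u = k - 1 < v
    not-above : v < V k → ⊥
    not-above v<Vk with maximum
    ... | q , Vq≡m with <-cmp (toℕ q) K
    ...   | tri< q<k _ _ = <⇒≱ v<Vk (≤-trans (s≤s⁻¹ (V<n k)) m≤v)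
      where
      m≤v = subst (m ≤_) (trans (cong (_+ toℕ q) (sym Vq≡m)) (earlier q<k (≤-trans (<⇒≤ q<k) K≤v))) (m≤m+n m (toℕ q))
    ...   | tri≈ _ Q≡K _ with maximum-wraps (after-top (λ Vk≡v → <-irrefl (sym Vk≡v) v<Vk)) K≤v
    ...     | u , u<v , m-k≡u = not-smaller-shift u<v (subst (λ x → Cyclic n x K u) (sym Vk≡m) m-k≡u)
      where
      Vk≡m = trans (cong V (toℕ-injective (sym Q≡K))) Vq≡m
    not-above v<Vk | q , Vq≡m | tri> _ _ k<q = no123 {k} {q} (after-top (λ Vk≡v → <-irrefl (sym Vk≡v) v<Vk)) k<q v<Vk Vk<Vq
      where
      Vk<Vq : V k < V q
      Vk<Vq = subst (V k <_) (sym Vq≡m) (≤∧≢⇒< (s≤s⁻¹ (V<n k)) λ Vk≡m → <-irrefl (same-value (trans Vk≡m (sym Vq≡m))) k<q)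

    -- a value x ≤ v: if x + k > v then x was already used at the earlier position
    -- v - x, and if x + k < v then x = u - k for u = x + k < v
    step : V k + K ≡ v
    step with <-cmp (V k + K) v
    ... | tri≈ _ eq _ = eq
    ... | tri< Vk+K<v _ _ = ⊥-elim (not-smaller-shift Vk+K<v (no-wrap (<-trans Vk+K<v (V<n zero)) refl))
    ... | tri> _ _ v<Vk+K with <-cmp (V k) v
    ...   | tri> _ _ v<Vk = ⊥-elim (not-above v<Vk)
    ...   | tri≈ _ Vk≡v _ = ⊥-elim (<-irrefl (sym (trans (cong₂ _+_ Vk≡v (same-value Vk≡v)) (+-identityʳ v))) v<Vk+K)
    ...   | tri< Vk<v _ _ with home-early (<⇒≤ Vk<v)
    ...     | k' , Vk+K'≡v = ⊥-elim (<-irrefl (same-value Vk'≡Vk) K'<K)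
      where
      K'<K = +-cancelˡ-< (V k) _ K (subst (_< V k + K) (sym Vk+K'≡v) v<Vk+K)
      K'≤v = subst (toℕ k' ≤_) Vk+K'≡v (m≤n+m (toℕ k') (V k))
      Vk'≡Vk = +-cancelʳ-≡ (toℕ k') _ _ (trans (earlier K'<K K'≤v) (sym Vk+K'≡v))

  early : ∀ k → Early k
  early = All.wfRec <-wellFounded 0ℓ Early λ k earlier → EarlyStep.step k earlier

  Late : Fin n → Set
  Late k = v < toℕ k → V k + toℕ k ≡ v + n

  module LateStep (k : Fin n) (earlier : ∀ {k'} → toℕ k' < toℕ k → Late k') (v<K : v < toℕ k) where
    K = toℕ k

    -- values up to v live at the early positions
    not-below : V k ≤ v → ⊥
    not-below Vk≤v with home-early Vk≤v
    ... | k' , Vk+K'≡v = <⇒≱ v<K (subst (_≤ v) (same-value Vk'≡Vk) K'≤v)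
      where
      K'≤v = subst (toℕ k' ≤_) Vk+K'≡v (m≤n+m (toℕ k') (V k))
      Vk'≡Vk = +-cancelʳ-≡ (toℕ k') _ _ (trans (early k' K'≤v) (sym Vk+K'≡v))

    -- the value that belongs at k
    w : ℕ
    w = v + n ∸ K

    w+K≡v+n : w + K ≡ v + n
    w+K≡v+n = m∸n+n≡m (≤-trans (<⇒≤ (toℕ<n k)) (m≤n+m n v))

    w<n : w < n
    w<n = +-cancelʳ-< K w n (subst₂ _<_ (sym w+K≡v+n) (+-comm K n) (+-monoˡ-< n v<K))

    -- a value x > v with x < w: then w sits neither earlier (contradicting `early`
    -- or the induction hypothesis) nor later (v, x, w would be a 123)
    not-short : v < V k → V k < w → ⊥
    not-short v<Vk Vk<w with position-of w w<n
    ... | p , Vp≡w with <-cmp (toℕ p) K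
    ...   | tri≈ _ P≡K _ = <-irrefl (trans (cong V (toℕ-injective (sym P≡K))) Vp≡w) Vk<w
    ...   | tri> _ _ k<p = no123 {k} {p} (≤-<-trans z≤n v<K) k<p v<Vk (subst (V k <_) (sym Vp≡w) Vk<w)
    ...   | tri< p<k _ _ with toℕ p ≤? v
    ...     | yes P≤v = <⇒≱ (<-trans v<Vk Vk<w) (subst (_≤ v) Vp≡w (subst (V p ≤_) (early p P≤v) (m≤m+n (V p) (toℕ p))))
    ...     | no P≰v = <-irrefl (+-cancelˡ-≡ w _ _ (trans (cong (_+ toℕ p) (sym Vp≡w)) (trans (earlier p<k (≰⇒> P≰v)) (sym w+K≡v+n)))) p<k

    step : V k + K ≡ v + n
    step with V k ≤? v
    ... | yes Vk≤v = ⊥-elim (not-below Vk≤v)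
    ... | no Vk≰v with <-cmp (V k) w
    ...   | tri< Vk<w _ _ = ⊥-elim (not-short (≰⇒> Vk≰v) Vk<w)
    ...   | tri≈ _ Vk≡w _ = trans (cong (_+ K) Vk≡w) w+K≡v+n
    ...   | tri> _ _ w<Vk = ⊥-elim (<-irrefl (trans (sym (proj₂ at)) (same-value Vk'≡Vk)) K'<K)
      where
      -- x > w was already used at the earlier position v + n - x
      K' = v + n ∸ V k
      Vk+K'≡v+n : V k + K' ≡ v + n
      Vk+K'≡v+n = m+[n∸m]≡n (≤-trans (<⇒≤ (V<n k)) (m≤n+m n v))
      K'<K : K' < K
      K'<K = +-cancelˡ-< (V k) K' K (subst (_< V k + K) (trans w+K≡v+n (sym Vk+K'≡v+n)) (+-monoˡ-< K w<Vk))
      v<K' : v < K'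
      v<K' = +-cancelˡ-< (V k) v K' (subst₂ _<_ (+-comm v (V k)) (sym Vk+K'≡v+n) (+-monoʳ-< v (V<n k)))
      at = position K' (<-trans K'<K (toℕ<n k))
      k' = proj₁ at
      Vk'≡Vk : V k' ≡ V k
      Vk'≡Vk = +-cancelʳ-≡ K' _ _ (trans (subst (λ K'' → V k' + K'' ≡ v + n) (proj₂ at)
        (earlier (subst (_< K) (sym (proj₂ at)) K'<K) (subst (v <_) (sym (proj₂ at)) v<K'))) (sym Vk+K'≡v+n))

  late : ∀ k → Late k
  late = All.wfRec <-wellFounded 0ℓ Late λ k earlier → LateStep.step k earlier

  forced : ∀ k → lookup σ k ≡ shiftDown (lookup σ zero) k
  forced k = toℕ-injective (cyclic-cancelˡ (V<n k) (toℕ<n (shiftDown (lookup σ zero) k)) Vk+k≡v (shiftDown-cyclic (lookup σ zero) k))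
    where
    Vk+k≡v : Cyclic n (V k) (toℕ k) v
    Vk+k≡v with toℕ k ≤? v
    ... | yes K≤v = no-wrap (subst (_< n) (sym (early k K≤v)) (V<n zero)) (sym (early k K≤v))
    ... | no K≰v = wrap (subst (n ≤_) (sym (late k (≰⇒> K≰v))) (m≤n+m n v)) (sym (late k (≰⇒> K≰v)))

-- A family of columns `shift u` (indexed by their top entry u) that governs the
-- Latin squares with π-avoiding columns: every shift avoids π, the shifts fit
-- together into Latin squares, and a π-avoiding column that differs at every
-- position from all shifts with smaller top entry is itself a shift.
record ColumnFamily (m : ℕ) (π : Vec (Fin 3) 3) : Set where
  field
    shift : Fin (suc m) → Fin (suc m) → Fin (suc m)
    shift-zero : ∀ u → shift u zero ≡ u
    shift-injectiveˡ : ∀ k {u u'} → shift u k ≡ shift u' k → u ≡ u'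
    shift-injectiveʳ : ∀ u {k k'} → shift u k ≡ shift u k' → k ≡ k'
    shift-avoids : ∀ u → Avoids (tabulate (shift u)) π
    forced : ∀ σ → IsPerm σ → Avoids σ π → (∀ u k → u Fin.< lookup σ zero → lookup σ k ≢ shift u k)
      → ∀ k → lookup σ k ≡ shift (lookup σ zero) k

increasing-family : ∀ m → ColumnFamily m π132
increasing-family m = record
  { shift = shiftUp
  ; shift-zero = shiftUp-zero
  ; shift-injectiveˡ = shiftUp-injectiveˡ
  ; shift-injectiveʳ = shiftUp-injectiveʳ
  ; shift-avoids = shiftUp-avoids
  ; forced = IncreasingColumn.forced
  }

decreasing-family : ∀ m → ColumnFamily m π123
decreasing-family m = record
  { shift = shiftDown
  ; shift-zero = shiftDown-zero
  ; shift-injectiveˡ = shiftDown-injectiveˡ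
  ; shift-injectiveʳ = shiftDown-injectiveʳ
  ; shift-avoids = shiftDown-avoids
  ; forced = DecreasingColumn.forced
  }

ColumnAvoiding : ∀ {n} → Vec (Fin 3) 3 → Grid n → Set
ColumnAvoiding π L = IsLatin L × (∀ j → Avoids (column L j) π)

entry : ∀ {n} → Grid n → Fin n → Fin n → Fin n
entry L i j = lookup (lookup L i) j

column-entry : ∀ {n} (L : Grid n) j i → lookup (column L j) i ≡ entry L i j
column-entry L j i = lookup∘tabulate (λ i → entry L i j) i

module Counting {m} {π} (F : ColumnFamily m π) where
  open ColumnFamily F

  n : ℕ
  n = suc m

  -- By strong induction
  -- on the top entry u: column j with top u differs, row by row, from the columns
  -- with smaller tops (the rows are permutations), which are shifts already.
  rigid : ∀ L → ColumnAvoiding π L → ∀ j i → entry L i j ≡ shift (entry L zero j) i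
  rigid L ((rows , columns) , avoids) j i = All.wfRec <-wellFounded 0ℓ ShiftOfTop step (entry L zero j) j refl i
    where
    ShiftOfTop : Fin n → Set
    ShiftOfTop u = ∀ j → entry L zero j ≡ u → ∀ i → entry L i j ≡ shift u i

    step : ∀ u → (∀ {u'} → u' Fin.< u → ShiftOfTop u') → ShiftOfTop u
    step u smaller j top≡u i = begin
      entry L i j                           ≡⟨ column-entry L j i ⟨
      lookup (column L j) i                 ≡⟨ forced (column L j) (columns j) (avoids j) off-diagonal i ⟩
      shift (lookup (column L j) zero) i    ≡⟨ cong (λ t → shift t i) (trans (column-entry L j zero) top≡u) ⟩
      shift u i                             ∎
      where
      open ≡-Reasoning
      off-diagonal : ∀ u' k → u' Fin.< lookup (column L j) zero → lookup (column L j) k ≢ shift u' k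
      off-diagonal u' k u'<top column≡shift with perm-surjective {σ = row L zero} (rows zero) u'
      ... | j' , top'≡u' = <-irrefl (cong toℕ (trans (sym top'≡u') (trans (cong (entry L zero) j'≡j) top≡u))) u'<u
        where
        u'<u = subst (λ t → toℕ u' < toℕ t) (trans (column-entry L j zero) top≡u) u'<top
        j'≡j : j' ≡ j
        j'≡j = rows k j' j (trans (smaller u'<u j' top'≡u' k) (trans (sym column≡shift) (column-entry L j k)))

  square : Vec (Fin n) n → Grid n
  square τ = tabulate λ i → tabulate λ j → shift (lookup τ j) i

  square-entry : ∀ τ i j → entry (square τ) i j ≡ shift (lookup τ j) i
  square-entry τ i j = trans (cong (λ r → lookup r j) (lookup∘tabulate (λ i → tabulate λ j → shift (lookup τ j) i) i))
    (lookup∘tabulate (λ j → shift (lookup τ j) i) j)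

  -- the first row of square τ is τ, so distinct τ give distinct squares
  square-injective : ∀ {τ ρ} → square τ ≡ square ρ → τ ≡ ρ
  square-injective {τ} {ρ} eq = lookup-ext λ j → begin
    lookup τ j                   ≡⟨ shift-zero (lookup τ j) ⟨
    shift (lookup τ j) zero      ≡⟨ square-entry τ zero j ⟨
    entry (square τ) zero j      ≡⟨ cong (λ L → entry L zero j) eq ⟩
    entry (square ρ) zero j      ≡⟨ square-entry ρ zero j ⟩
    shift (lookup ρ j) zero      ≡⟨ shift-zero (lookup ρ j) ⟩
    lookup ρ j                   ∎
    where open ≡-Reasoning

  square-valid : ∀ τ → IsPerm τ → ColumnAvoiding π (square τ)
  square-valid τ τ-perm = (rows , columns) , avoids
    where
    column-shift : ∀ j → column (square τ) j ≡ tabulate (shift (lookup τ j))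
    column-shift j = lookup-ext λ i → trans (column-entry (square τ) j i) (trans (square-entry τ i j) (sym (lookup∘tabulate (shift (lookup τ j)) i)))
    rows : ∀ i → IsPerm (row (square τ) i)
    rows i j j' eq = τ-perm j j' (shift-injectiveˡ i (trans (sym (square-entry τ i j)) (trans eq (square-entry τ i j'))))
    columns : ∀ j → IsPerm (column (square τ) j)
    columns j i i' eq = shift-injectiveʳ (lookup τ j) (begin
      shift (lookup τ j) i                       ≡⟨ lookup∘tabulate (shift (lookup τ j)) i ⟨
      lookup (tabulate (shift (lookup τ j))) i   ≡⟨ cong (λ c → lookup c i) (column-shift j) ⟨
      lookup (column (square τ) j) i             ≡⟨ eq ⟩
      lookup (column (square τ) j) i'            ≡⟨ cong (λ c → lookup c i') (column-shift j) ⟩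
      lookup (tabulate (shift (lookup τ j))) i'  ≡⟨ lookup∘tabulate (shift (lookup τ j)) i' ⟩
      shift (lookup τ j) i'                      ∎)
      where open ≡-Reasoning
    avoids : ∀ j → Avoids (column (square τ) j) π
    avoids j = subst (λ c → Avoids c π) (sym (column-shift j)) (shift-avoids (lookup τ j))

  square-of-top : ∀ L → ColumnAvoiding π L → L ≡ square (lookup L zero)
  square-of-top L valid = lookup-ext λ i → lookup-ext λ j → trans (rigid L valid j i) (sym (square-entry (lookup L zero) i j))

  count : HasCount (ColumnAvoiding π) (n !)
  count = List.map square (permutations n) , map⁺ square-injective (permutations-unique n) ,
    trans (length-map square (permutations n)) (permutations-length n) , λ L → mk⇔ (listed⇒valid L) (valid⇒listed L)
    where
    listed⇒valid : ∀ L → L ∈ List.map square (permutations n) → ColumnAvoiding π L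
    listed⇒valid L L∈ with ∈-map⁻ square L∈
    ... | τ , τ∈ , refl = square-valid τ (permutations-sound n τ∈)
    valid⇒listed : ∀ L → ColumnAvoiding π L → L ∈ List.map square (permutations n)
    valid⇒listed L valid = subst (_∈ List.map square (permutations n)) (sym (square-of-top L valid))
      (∈-map⁺ square (permutations-complete n {σ = lookup L zero} (proj₁ (proj₁ valid) zero)))

opposite-reverses : ∀ {n} {x y : Fin n} → x Fin.< y → opposite y Fin.< opposite x
opposite-reverses {n} {x} {y} x<y =
  subst₂ _<_ (sym (opposite-prop y)) (sym (opposite-prop x)) (∸-monoʳ-< (s≤s x<y) (toℕ<n y))

opposite-reflects : ∀ {n} {x y : Fin n} → opposite x Fin.< opposite y → y Fin.< x
opposite-reflects {x = x} {y} lt = subst₂ Fin._<_ (opposite-involutive y) (opposite-involutive x) (opposite-reverses lt)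

complement : ∀ {n k} → Vec (Fin n) k → Vec (Fin n) k
complement σ = tabulate (λ i → opposite (lookup σ i))

reverse : ∀ {A : Set} {k} → Vec A k → Vec A k
reverse σ = tabulate (λ i → lookup σ (opposite i))

lookup-complement : ∀ {n k} (σ : Vec (Fin n) k) i → lookup (complement σ) i ≡ opposite (lookup σ i)
lookup-complement σ = lookup∘tabulate (λ i → opposite (lookup σ i))

lookup-reverse : ∀ {A : Set} {k} (σ : Vec A k) i → lookup (reverse σ) i ≡ lookup σ (opposite i)
lookup-reverse σ = lookup∘tabulate (λ i → lookup σ (opposite i))

complement-involutive : ∀ {n k} (σ : Vec (Fin n) k) → complement (complement σ) ≡ σ
complement-involutive σ = lookup-ext λ i →
  trans (lookup-complement (complement σ) i) (trans (cong opposite (lookup-complement σ i)) (opposite-involutive _))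

reverse-involutive : ∀ {A : Set} {k} (σ : Vec A k) → reverse (reverse σ) ≡ σ
reverse-involutive σ = lookup-ext λ i →
  trans (lookup-reverse (reverse σ) i) (trans (lookup-reverse σ (opposite i)) (cong (lookup σ) (opposite-involutive i)))

complement-perm : ∀ {n} {σ : Vec (Fin n) n} → IsPerm σ → IsPerm (complement σ)
complement-perm {σ = σ} σ-perm i j eq = σ-perm i j (begin
  lookup σ i                        ≡⟨ opposite-involutive _ ⟨
  opposite (opposite (lookup σ i))  ≡⟨ cong opposite (trans (sym (lookup-complement σ i)) (trans eq (lookup-complement σ j))) ⟩
  opposite (opposite (lookup σ j))  ≡⟨ opposite-involutive _ ⟩
  lookup σ j                        ∎)
  where open ≡-Reasoning

reverse-perm : ∀ {n} {σ : Vec (Fin n) n} → IsPerm σ → IsPerm (reverse σ)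
reverse-perm {σ = σ} σ-perm i j eq = begin
  i                        ≡⟨ opposite-involutive i ⟨
  opposite (opposite i)    ≡⟨ cong opposite (σ-perm _ _ (trans (sym (lookup-reverse σ i)) (trans eq (lookup-reverse σ j)))) ⟩
  opposite (opposite j)    ≡⟨ opposite-involutive j ⟩
  j                        ∎
  where open ≡-Reasoning

complement-contains : ∀ {n k} {σ : Vec (Fin n) n} {π : Vec (Fin k) k} → Contains σ π → Contains (complement σ) (complement π)
complement-contains {σ = σ} {π} (f , f-inc , iff) = f , f-inc , λ a b → mk⇔ (preserve a b) (reflect a b)
  where
  -- both sides of the equivalence are the swapped comparison, seen through opposite
  flipped : ∀ {n k} (τ : Vec (Fin n) k) a b → lookup (complement τ) a Fin.< lookup (complement τ) b → lookup τ b Fin.< lookup τ a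
  flipped τ a b lt = opposite-reflects (subst₂ Fin._<_ (lookup-complement τ a) (lookup-complement τ b) lt)
  unflipped : ∀ {n k} (τ : Vec (Fin n) k) a b → lookup τ b Fin.< lookup τ a → lookup (complement τ) a Fin.< lookup (complement τ) b
  unflipped τ a b lt = subst₂ Fin._<_ (sym (lookup-complement τ a)) (sym (lookup-complement τ b)) (opposite-reverses lt)
  preserve : ∀ a b → lookup (complement π) a Fin.< lookup (complement π) b → lookup (complement σ) (f a) Fin.< lookup (complement σ) (f b)
  preserve a b lt = unflipped σ (f a) (f b) (Equivalence.to (iff b a) (flipped π a b lt))
  reflect : ∀ a b → lookup (complement σ) (f a) Fin.< lookup (complement σ) (f b) → lookup (complement π) a Fin.< lookup (complement π) b
  reflect a b lt = unflipped π a b (Equivalence.from (iff b a) (flipped σ (f a) (f b) lt))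

reverse-contains : ∀ {n k} {σ : Vec (Fin n) n} {π : Vec (Fin k) k} → Contains σ π → Contains (reverse σ) (reverse π)
reverse-contains {σ = σ} {π} (f , f-inc , iff) = g , g-inc , λ a b → mk⇔ (preserve a b) (reflect a b)
  where
  g : _ → _
  g a = opposite (f (opposite a))
  g-inc : StrictlyIncreasing g
  g-inc a b a<b = opposite-reverses (f-inc _ _ (opposite-reverses a<b))
  σg : ∀ a → lookup (reverse σ) (g a) ≡ lookup σ (f (opposite a))
  σg a = trans (lookup-reverse σ (g a)) (cong (lookup σ) (opposite-involutive _))
  preserve : ∀ a b → lookup (reverse π) a Fin.< lookup (reverse π) b → lookup (reverse σ) (g a) Fin.< lookup (reverse σ) (g b)
  preserve a b lt = subst₂ Fin._<_ (sym (σg a)) (sym (σg b))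
    (Equivalence.to (iff _ _) (subst₂ Fin._<_ (lookup-reverse π a) (lookup-reverse π b) lt))
  reflect : ∀ a b → lookup (reverse σ) (g a) Fin.< lookup (reverse σ) (g b) → lookup (reverse π) a Fin.< lookup (reverse π) b
  reflect a b lt = subst₂ Fin._<_ (sym (lookup-reverse π a)) (sym (lookup-reverse π b))
    (Equivalence.from (iff _ _) (subst₂ Fin._<_ (σg a) (σg b) lt))

complement-avoids : ∀ {n k} {σ : Vec (Fin n) n} {π : Vec (Fin k) k} → Avoids σ π → Avoids (complement σ) (complement π)
complement-avoids {σ = σ} {π} σ-avoids occurrence =
  σ-avoids (subst₂ Contains (complement-involutive σ) (complement-involutive π) (complement-contains {σ = complement σ} {complement π} occurrence))

reverse-avoids : ∀ {n k} {σ : Vec (Fin n) n} {π : Vec (Fin k) k} → Avoids σ π → Avoids (reverse σ) (reverse π)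
reverse-avoids {σ = σ} {π} σ-avoids occurrence =
  σ-avoids (subst₂ Contains (reverse-involutive σ) (reverse-involutive π) (reverse-contains {σ = reverse σ} {reverse π} occurrence))

complementGrid : ∀ {n} → Grid n → Grid n
complementGrid L = tabulate λ i → complement (lookup L i)

reverseGrid : ∀ {n} → Grid n → Grid n
reverseGrid L = tabulate λ i → lookup L (opposite i)

transpose : ∀ {n} → Grid n → Grid n
transpose L = tabulate (column L)

row-complementGrid : ∀ {n} (L : Grid n) i → row (complementGrid L) i ≡ complement (row L i)
row-complementGrid L = lookup∘tabulate (λ i → complement (lookup L i))

column-complementGrid : ∀ {n} (L : Grid n) j → column (complementGrid L) j ≡ complement (column L j)
column-complementGrid L j = lookup-ext λ i → begin
  lookup (column (complementGrid L) j) i  ≡⟨ column-entry (complementGrid L) j i ⟩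
  lookup (row (complementGrid L) i) j     ≡⟨ cong (λ r → lookup r j) (row-complementGrid L i) ⟩
  lookup (complement (row L i)) j         ≡⟨ lookup-complement (row L i) j ⟩
  opposite (entry L i j)                  ≡⟨ cong opposite (column-entry L j i) ⟨
  opposite (lookup (column L j) i)        ≡⟨ lookup-complement (column L j) i ⟨
  lookup (complement (column L j)) i      ∎
  where open ≡-Reasoning

row-reverseGrid : ∀ {n} (L : Grid n) i → row (reverseGrid L) i ≡ row L (opposite i)
row-reverseGrid L = lookup∘tabulate (λ i → lookup L (opposite i))

column-reverseGrid : ∀ {n} (L : Grid n) j → column (reverseGrid L) j ≡ reverse (column L j)
column-reverseGrid L j = lookup-ext λ i → begin
  lookup (column (reverseGrid L) j) i  ≡⟨ column-entry (reverseGrid L) j i ⟩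
  lookup (row (reverseGrid L) i) j     ≡⟨ cong (λ r → lookup r j) (row-reverseGrid L i) ⟩
  entry L (opposite i) j               ≡⟨ column-entry L j (opposite i) ⟨
  lookup (column L j) (opposite i)     ≡⟨ lookup-reverse (column L j) i ⟨
  lookup (reverse (column L j)) i      ∎
  where open ≡-Reasoning

row-transpose : ∀ {n} (L : Grid n) i → row (transpose L) i ≡ column L i
row-transpose L = lookup∘tabulate (column L)

column-transpose : ∀ {n} (L : Grid n) j → column (transpose L) j ≡ row L j
column-transpose L j = lookup-ext λ i →
  trans (column-entry (transpose L) j i) (trans (cong (λ r → lookup r j) (row-transpose L i)) (column-entry L i j))

complementGrid-involutive : ∀ {n} (L : Grid n) → complementGrid (complementGrid L) ≡ L
complementGrid-involutive L = lookup-ext λ i →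
  trans (row-complementGrid (complementGrid L) i) (trans (cong complement (row-complementGrid L i)) (complement-involutive (row L i)))

reverseGrid-involutive : ∀ {n} (L : Grid n) → reverseGrid (reverseGrid L) ≡ L
reverseGrid-involutive L = lookup-ext λ i →
  trans (row-reverseGrid (reverseGrid L) i) (trans (row-reverseGrid L (opposite i)) (cong (lookup L) (opposite-involutive i)))

transpose-involutive : ∀ {n} (L : Grid n) → transpose (transpose L) ≡ L
transpose-involutive L = lookup-ext λ i → trans (row-transpose (transpose L) i) (column-transpose L i)

complementGrid-latin : ∀ {n} (L : Grid n) → IsLatin L → IsLatin (complementGrid L)
complementGrid-latin L (rows , columns) =
  (λ i → subst IsPerm (sym (row-complementGrid L i)) (complement-perm {σ = row L i} (rows i))) ,
  (λ j → subst IsPerm (sym (column-complementGrid L j)) (complement-perm {σ = column L j} (columns j)))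

reverseGrid-latin : ∀ {n} (L : Grid n) → IsLatin L → IsLatin (reverseGrid L)
reverseGrid-latin L (rows , columns) =
  (λ i → subst IsPerm (sym (row-reverseGrid L i)) (rows (opposite i))) ,
  (λ j → subst IsPerm (sym (column-reverseGrid L j)) (reverse-perm {σ = column L j} (columns j)))

transpose-latin : ∀ {n} (L : Grid n) → IsLatin L → IsLatin (transpose L)
transpose-latin L (rows , columns) =
  (λ i → subst IsPerm (sym (row-transpose L i)) (columns i)) ,
  (λ j → subst IsPerm (sym (column-transpose L j)) (rows j))

transfer : ∀ {A : Set} {P Q : A → Set} {k} (f : A → A) → (∀ x → f (f x) ≡ x)
  → (∀ x → P x → Q (f x)) → (∀ x → Q x → P (f x)) → HasCount P k → HasCount Q k
transfer {P = P} {Q} f f-involutive P⇒Q Q⇒P (xs , xs-unique , xs-length , xs-complete) =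
  List.map f xs , map⁺ f-injective xs-unique , trans (length-map f xs) xs-length , λ x → mk⇔ (listed⇒Q x) (Q⇒listed x)
  where
  f-injective : ∀ {x y} → f x ≡ f y → x ≡ y
  f-injective {x} {y} eq = trans (sym (f-involutive x)) (trans (cong f eq) (f-involutive y))
  listed⇒Q : ∀ x → x ∈ List.map f xs → Q x
  listed⇒Q x x∈ with ∈-map⁻ f x∈
  ... | y , y∈ , refl = P⇒Q y (Equivalence.to (xs-complete y) y∈)
  Q⇒listed : ∀ x → Q x → x ∈ List.map f xs
  Q⇒listed x Qx = subst (_∈ List.map f xs) (f-involutive x) (∈-map⁺ f (Equivalence.from (xs-complete (f x)) (Q⇒P x Qx)))

RowAvoiding : ∀ {n} → Vec (Fin 3) 3 → Grid n → Set
RowAvoiding π L = IsLatin L × (∀ i → Avoids (row L i) π)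

complementGrid-valid : ∀ {n} π (L : Grid n) → ColumnAvoiding π L → ColumnAvoiding (complement π) (complementGrid L)
complementGrid-valid π L (latin , avoids) = complementGrid-latin L latin ,
  λ j → subst (λ c → Avoids c (complement π)) (sym (column-complementGrid L j)) (complement-avoids {σ = column L j} {π} (avoids j))

reverseGrid-valid : ∀ {n} π (L : Grid n) → ColumnAvoiding π L → ColumnAvoiding (reverse π) (reverseGrid L)
reverseGrid-valid π L (latin , avoids) = reverseGrid-latin L latin ,
  λ j → subst (λ c → Avoids c (reverse π)) (sym (column-reverseGrid L j)) (reverse-avoids {σ = column L j} {π} (avoids j))

complement-count : ∀ {n k} π → HasCount (ColumnAvoiding {n} π) k → HasCount (ColumnAvoiding {n} (complement π)) k
complement-count π = transfer complementGrid complementGrid-involutive (complementGrid-valid π)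
  λ L valid → subst (λ ρ → ColumnAvoiding ρ (complementGrid L)) (complement-involutive π) (complementGrid-valid (complement π) L valid)

reverse-count : ∀ {n k} π → HasCount (ColumnAvoiding {n} π) k → HasCount (ColumnAvoiding {n} (reverse π)) k
reverse-count π = transfer reverseGrid reverseGrid-involutive (reverseGrid-valid π)
  λ L valid → subst (λ ρ → ColumnAvoiding ρ (reverseGrid L)) (reverse-involutive π) (reverseGrid-valid (reverse π) L valid)

rows-count : ∀ {n k} π → HasCount (ColumnAvoiding {n} π) k → HasCount (RowAvoiding {n} π) k
rows-count π = transfer transpose transpose-involutive
  (λ L (latin , avoids) → transpose-latin L latin , λ i → subst (λ r → Avoids r π) (sym (row-transpose L i)) (avoids i))
  (λ L (latin , avoids) → transpose-latin L latin , λ j → subst (λ c → Avoids c π) (sym (column-transpose L j)) (avoids j))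

-- A word with a repeated letter is not a permutation, and every π ∈ S₃ is 123
-- or 132 up to complement and reverse: 321 = complement 123,
-- 312 = complement 132, 231 = reverse 132, 213 = complement (reverse 132).
column-count : ∀ m (π : Vec (Fin 3) 3) → IsPerm π → HasCount (ColumnAvoiding {suc m} π) (suc m !)
column-count m (zero ∷ zero ∷ _ ∷ []) π-perm with () ← π-perm zero (suc zero) refl
column-count m (suc zero ∷ suc zero ∷ _ ∷ []) π-perm with () ← π-perm zero (suc zero) refl
column-count m (suc (suc zero) ∷ suc (suc zero) ∷ _ ∷ []) π-perm with () ← π-perm zero (suc zero) refl
column-count m (zero ∷ _ ∷ zero ∷ []) π-perm with () ← π-perm zero (suc (suc zero)) refl
column-count m (suc zero ∷ _ ∷ suc zero ∷ []) π-perm with () ← π-perm zero (suc (suc zero)) refl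
column-count m (suc (suc zero) ∷ _ ∷ suc (suc zero) ∷ []) π-perm with () ← π-perm zero (suc (suc zero)) refl
column-count m (_ ∷ zero ∷ zero ∷ []) π-perm with () ← π-perm (suc zero) (suc (suc zero)) refl
column-count m (_ ∷ suc zero ∷ suc zero ∷ []) π-perm with () ← π-perm (suc zero) (suc (suc zero)) refl
column-count m (_ ∷ suc (suc zero) ∷ suc (suc zero) ∷ []) π-perm with () ← π-perm (suc zero) (suc (suc zero)) refl
column-count m (zero ∷ suc zero ∷ suc (suc zero) ∷ []) _ = Counting.count (decreasing-family m)
column-count m (zero ∷ suc (suc zero) ∷ suc zero ∷ []) _ = Counting.count (increasing-family m)
column-count m (suc zero ∷ zero ∷ suc (suc zero) ∷ []) _ = complement-count (reverse π132) (reverse-count π132 (Counting.count (increasing-family m)))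
column-count m (suc zero ∷ suc (suc zero) ∷ zero ∷ []) _ = reverse-count π132 (Counting.count (increasing-family m))
column-count m (suc (suc zero) ∷ zero ∷ suc zero ∷ []) _ = complement-count π132 (Counting.count (increasing-family m))
column-count m (suc (suc zero) ∷ suc zero ∷ zero ∷ []) _ = complement-count π123 (Counting.count (decreasing-family m))

corollary4 : (n : ℕ) → n ≥ 1 → (π : Vec (Fin 3) 3) → IsPerm π
    → HasCount (λ (L : Grid n) → IsLatin L × (∀ j → Avoids (column L j) π)) (n !)
      × HasCount (λ (L : Grid n) → IsLatin L × (∀ i → Avoids (row L i) π)) (n !)
corollary4 (suc m) _ π π-perm = column-count m π π-perm , rows-count π (column-count m π π-perm)
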